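{- Let $n\ge 5$ be an integer and let $A=L\cup R$ be an MSTD set that is $P_{n-4}$ and contains $5$ and $2n-4$, where $L\subseteq[5,n]$ and $R\subseteq[n+1,2n-4]$. Let $m\ge0$ be an integer, let $M\subseteq[n+1,n+m]$, let $R'=R+m$, and form $A'=L\cup M\cup R'$. If $A'$ is $SP_{n-4}$, then $A'$ is MSTD.
   Context: For integers $a\le b$, $[a,b]=\{\ell\in\mathbb{Z}:a\le\ell\le b\}$. For a set $A$ of integers, $A+A=\{x+y:x,y\in A\}$, $A-A=\{x-y:x,y\in A\}$, $A+t=\{x+t:x\in A\}$. A finite set $A$ is MSTD if $|A+A|>|A-A|$. For a finite set $A$ with $a=\min A$, $b=\max A$: $A$ is $SP_j$ if $A+A\supseteq[2a+j,2b-j]$; $A$ is $P_j$ if it is $SP_j$ and additionally $A-A\supseteq[(a-b)+j,(b-a)-j]$. -}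

module Defs where

open import Data.Integer using (ℤ; _+_; _-_; _*_; _≤_; _<_; +_)
open import Data.Integer.Properties using (_≟_)
open import Data.List using (List; map; concatMap; length; deduplicate)
open import Data.List.Membership.Propositional using (_∈_)
open import Data.List.Relation.Unary.All using (All)
open import Data.Nat using (ℕ)
open import Data.Product using (_×_)

-- Finite sets of integers are represented as lists (duplicates allowed);
-- membership is list membership and cardinality counts distinct elements.

card : List ℤ → ℕ
card xs = length (deduplicate _≟_ xs)

sumset : List ℤ → List ℤ
sumset A = concatMap (λ x → map (λ y → x + y) A) A

diffset : List ℤ → List ℤ
diffset A = concatMap (λ x → map (λ y → x - y) A) A

shift : ℤ → List ℤ → List ℤ
shift t A = map (λ x → x + t) A

InInterval : ℤ → ℤ → List ℤ → Set
InInterval lo hi A = All (λ x → lo ≤ x × x ≤ hi) A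

MSTD : List ℤ → Set
MSTD A = card (diffset A) Data.Nat.< card (sumset A)

IsMin : ℤ → List ℤ → Set
IsMin a A = a ∈ A × All (λ x → a ≤ x) A

IsMax : ℤ → List ℤ → Set
IsMax b A = b ∈ A × All (λ x → x ≤ b) A

SP : ℤ → List ℤ → Set
SP j A = ∀ a b → IsMin a A → IsMax b A →
         ∀ k → (+ 2) * a + j ≤ k → k ≤ (+ 2) * b - j → k ∈ sumset A

P : ℤ → List ℤ → Set
P j A = SP j A × (∀ a b → IsMin a A → IsMax b A →
         ∀ k → (a - b) + j ≤ k → k ≤ (b - a) - j → k ∈ diffset A)

module Submission where

-- Write n = 5 + t.  Then A = L ∪ R ⊆ [5, 2n-4] and A' ⊆ [5, 2n-4+m],
-- with 5 ∈ L and 2n-4 ∈ R, so the extremes are known.  Cut the range of each sum-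
-- and difference set into a low, a central and a high window.
--   Sums: below n+6 only L+L occurs, and L+L ⊆ A'+A'; above 3n-4 only R+R occurs,
--   and R+R+2m ⊆ A'+A'.  The central window of A'+A' has 2n-9+2m elements and is
--   filled completely by SP_{n-4}, while that of A+A has at most 2n-9.  Hence
--   |A+A| + 2m ≤ |A'+A'|.
--   Differences: a difference of A' of size ≥ n-4+m must be (r+m)-l with r ∈ R,
--   l ∈ L, so the outer windows of A'-A' embed (shifted by ∓m) into those of A-A;
--   the central window of A-A is full by P_{n-4}, while that of A'-A' has at most
--   2n-9+2m elements.  Hence |A'-A'| ≤ |A-A| + 2m.
-- Together with |A-A| < |A+A| this gives |A'-A'| < |A'+A'|.

open import Defs
open import Data.Nat using (ℕ)
open import Data.Integer using (ℤ; _+_; _-_; _*_; _≤_; +_)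
open import Data.List using (List; _++_)
open import Data.List.Membership.Propositional using (_∈_)
open import Data.Nat as ℕ using (zero; suc; s≤s; z≤n)
import Data.Nat.Properties as ℕP
open import Data.Nat.Tactic.RingSolver renaming (solve-∀ to ℕ-solve-∀)
open import Data.Integer using (-_; -[1+_]; +≤+)
import Data.Integer.Properties as ℤP
open import Data.Integer.Properties using (_≟_)
open import Data.Integer.Tactic.RingSolver using (solve-∀)
open import Data.List using ([]; _∷_; map; concatMap; length; deduplicate)
open import Data.List.Membership.Propositional using (_∉_; find; lose)
open import Data.List.Membership.Propositional.Properties
  using (∈-concatMap⁻; ∈-concatMap⁺; ∈-map⁻; ∈-map⁺; ∈-++⁻; ∈-++⁺ˡ; ∈-++⁺ʳ;
         ∈-deduplicate⁻; ∈-deduplicate⁺)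
open import Data.List.Membership.DecPropositional _≟_ using (_∈?_)
open import Data.List.Relation.Unary.All as All using (All)
open import Data.List.Relation.Unary.Any using (here; there)
open import Data.List.Relation.Unary.Unique.Propositional using (Unique)
open import Data.List.Relation.Unary.AllPairs using (_∷_)
open import Data.List.Relation.Unary.Unique.DecPropositional.Properties _≟_ using (deduplicate-!)
open import Data.Product using (∃; _×_; _,_; proj₁; proj₂)
open import Data.Sum using (inj₁; inj₂)
open import Data.Empty using (⊥; ⊥-elim)
open import Relation.Nullary using (Dec; yes; no)
open import Relation.Binary.PropositionalEquality

-- An inequality a ≤ b is recorded by its nonnegative slack b - a.  A linear
-- fact follows by writing the target slack as a sum of known slacks, and a
-- contradiction by writing -1 as such a sum; the identities involved are
-- checked by the ring solver.

NonNeg : ℤ → Set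
NonNeg d = + 0 ≤ d

slack : ∀ {a b} → a ≤ b → NonNeg (b - a)
slack {a} {b} a≤b =
  ℤP.≤-trans (ℤP.≤-reflexive (sym (ℤP.+-inverseʳ a))) (ℤP.+-monoˡ-≤ (- a) a≤b)

infixl 6 _⊕_
_⊕_ : ∀ {d e} → NonNeg d → NonNeg e → NonNeg (d + e)
_⊕_ = ℤP.+-mono-≤

natural : ∀ c → NonNeg (+ c)
natural c = +≤+ z≤n

≤-by : ∀ {a b d} → NonNeg d → b ≡ a + d → a ≤ b
≤-by {a} {d = d} d≥0 refl =
  subst (_≤ a + d) (ℤP.+-identityʳ a) (ℤP.+-monoʳ-≤ a d≥0)

infeasible : ∀ {d} → NonNeg d → d ≡ -[1+ 0 ] → ⊥
infeasible () refl

∈-pairwise⁻ : ∀ (g : ℤ → ℤ → ℤ) A B k → k ∈ concatMap (λ x → map (g x) B) A →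
              ∃ λ x → ∃ λ y → x ∈ A × y ∈ B × k ≡ g x y
∈-pairwise⁻ g A B k k∈ with find (∈-concatMap⁻ (λ x → map (g x) B) {xs = A} k∈)
... | x , x∈ , k∈row with ∈-map⁻ (g x) k∈row
... | y , y∈ , k≡ = x , y , x∈ , y∈ , k≡

∈-pairwise⁺ : ∀ (g : ℤ → ℤ → ℤ) A B {x y} → x ∈ A → y ∈ B →
              g x y ∈ concatMap (λ x → map (g x) B) A
∈-pairwise⁺ g A B {x} x∈ y∈ =
  ∈-concatMap⁺ (λ x → map (g x) B) {xs = A} (lose x∈ (∈-map⁺ (g x) y∈))

∈-sumset⁻ : ∀ A k → k ∈ sumset A → ∃ λ x → ∃ λ y → x ∈ A × y ∈ A × k ≡ x + y
∈-sumset⁻ A = ∈-pairwise⁻ _+_ A A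

∈-sumset⁺ : ∀ A {x y} → x ∈ A → y ∈ A → x + y ∈ sumset A
∈-sumset⁺ A = ∈-pairwise⁺ _+_ A A

∈-diffset⁻ : ∀ A k → k ∈ diffset A → ∃ λ x → ∃ λ y → x ∈ A × y ∈ A × k ≡ x - y
∈-diffset⁻ A = ∈-pairwise⁻ _-_ A A

∈-diffset⁺ : ∀ A {x y} → x ∈ A → y ∈ A → x - y ∈ diffset A
∈-diffset⁺ A = ∈-pairwise⁺ _-_ A A

InWindow : ℤ → ℕ → ℤ → Set
InWindow lo len k = lo ≤ k × k + + 1 ≤ lo + + len

windowSum : (ℤ → ℕ) → ℤ → ℕ → ℕ
windowSum f lo zero = 0
windowSum f lo (suc len) = f lo ℕ.+ windowSum f (lo + + 1) len

InWindow-first : ∀ lo len → InWindow lo (suc len) lo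
InWindow-first lo len = ℤP.≤-refl , ℤP.+-monoʳ-≤ lo (+≤+ (s≤s z≤n))

InWindow-rest : ∀ lo len k → InWindow (lo + + 1) len k → InWindow lo (suc len) k
InWindow-rest lo len k (lo+1≤k , k<end) =
  ℤP.≤-trans (ℤP.i≤i+j lo (+ 1)) lo+1≤k ,
  subst (k + + 1 ≤_) (ℤP.+-assoc lo (+ 1) (+ len)) k<end

windowSum-shift-≤ : ∀ f g c lo lo' len → lo + c ≡ lo' →
  (∀ k → InWindow lo len k → f k ℕ.≤ g (k + c)) →
  windowSum f lo len ℕ.≤ windowSum g lo' len
windowSum-shift-≤ f g c lo lo' zero _ f≤g = z≤n
windowSum-shift-≤ f g c lo lo' (suc len) refl f≤g =
  ℕP.+-mono-≤ (f≤g lo (InWindow-first lo len))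
    (windowSum-shift-≤ f g c (lo + + 1) (lo' + + 1) len (shift-comm lo c)
      (λ k k∈ → f≤g k (InWindow-rest lo len k k∈)))
  where
  shift-comm : ∀ a b → (a + + 1) + b ≡ (a + b) + + 1
  shift-comm = solve-∀

windowSum-≤-width : ∀ f lo len → (∀ k → f k ℕ.≤ 1) → windowSum f lo len ℕ.≤ len
windowSum-≤-width f lo zero f≤1 = z≤n
windowSum-≤-width f lo (suc len) f≤1 =
  ℕP.+-mono-≤ (f≤1 lo) (windowSum-≤-width f (lo + + 1) len f≤1)

windowSum-full : ∀ f lo len → (∀ k → InWindow lo len k → 1 ℕ.≤ f k) →
                 len ℕ.≤ windowSum f lo len
windowSum-full f lo zero f≥1 = z≤n
windowSum-full f lo (suc len) f≥1 =
  ℕP.+-mono-≤ (f≥1 lo (InWindow-first lo len))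
    (windowSum-full f (lo + + 1) len (λ k k∈ → f≥1 k (InWindow-rest lo len k k∈)))

windowSum-cong : ∀ f g lo len → (∀ k → f k ≡ g k) → windowSum f lo len ≡ windowSum g lo len
windowSum-cong f g lo zero f≡g = refl
windowSum-cong f g lo (suc len) f≡g = cong₂ ℕ._+_ (f≡g lo) (windowSum-cong f g (lo + + 1) len f≡g)

windowSum-+ : ∀ f g lo len →
  windowSum (λ k → f k ℕ.+ g k) lo len ≡ windowSum f lo len ℕ.+ windowSum g lo len
windowSum-+ f g lo zero = refl
windowSum-+ f g lo (suc len) =
  trans (cong (f lo ℕ.+ g lo ℕ.+_) (windowSum-+ f g (lo + + 1) len))
        (interchange (f lo) (g lo) _ _)
  where
  interchange : ∀ a b c d → a ℕ.+ b ℕ.+ (c ℕ.+ d) ≡ a ℕ.+ c ℕ.+ (b ℕ.+ d)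
  interchange = ℕ-solve-∀

windowSum-split : ∀ f lo a b → windowSum f lo (a ℕ.+ b) ≡ windowSum f lo a ℕ.+ windowSum f (lo + + a) b
windowSum-split f lo zero b = cong (λ s → windowSum f s b) (sym (ℤP.+-identityʳ lo))
windowSum-split f lo (suc a) b =
  trans (cong (f lo ℕ.+_)
          (trans (windowSum-split f (lo + + 1) a b)
                 (cong (λ s → windowSum f (lo + + 1) a ℕ.+ windowSum f s b)
                       (ℤP.+-assoc lo (+ 1) (+ a)))))
        (sym (ℕP.+-assoc (f lo) _ _))

windowSum-split₃ : ∀ f lo a b c lo₂ lo₃ → lo + + a ≡ lo₂ → lo₂ + + b ≡ lo₃ →
  windowSum f lo (a ℕ.+ (b ℕ.+ c)) ≡ windowSum f lo a ℕ.+ (windowSum f lo₂ b ℕ.+ windowSum f lo₃ c)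
windowSum-split₃ f lo a b c lo₂ lo₃ refl refl =
  trans (windowSum-split f lo a (b ℕ.+ c)) (cong (windowSum f lo a ℕ.+_) (windowSum-split f (lo + + a) b c))

indicator : List ℤ → ℤ → ℕ
indicator xs k with k ∈? xs
... | yes _ = 1
... | no _ = 0

indicator-≤1 : ∀ xs k → indicator xs k ℕ.≤ 1
indicator-≤1 xs k with k ∈? xs
... | yes _ = ℕP.≤-refl
... | no _ = z≤n

indicator-pos : ∀ xs k → k ∈ xs → 1 ℕ.≤ indicator xs k
indicator-pos xs k k∈ with k ∈? xs
... | yes _ = ℕP.≤-refl
... | no k∉ = ⊥-elim (k∉ k∈)

indicator-transport : ∀ xs ys k j → (k ∈ xs → j ∈ ys) → indicator xs k ℕ.≤ indicator ys j
indicator-transport xs ys k j k⇒j with k ∈? xs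
... | yes k∈ = indicator-pos ys j (k⇒j k∈)
... | no _ = z≤n

indicator-cong : ∀ xs ys k → (k ∈ xs → k ∈ ys) → (k ∈ ys → k ∈ xs) → indicator xs k ≡ indicator ys k
indicator-cong xs ys k to from =
  ℕP.≤-antisym (indicator-transport xs ys k k to) (indicator-transport ys xs k k from)

point : ℤ → ℤ → ℕ
point y k with k ≟ y
... | yes _ = 1
... | no _ = 0

-- Adding a new element y to a list adds the point indicator of y.  The case split on
-- k ≟ y goes through a helper so that the test inside `indicator` is not abstracted.
indicator-∷ : ∀ y ys k → y ∉ ys → indicator (y ∷ ys) k ≡ point y k ℕ.+ indicator ys k
indicator-∷ y ys k y∉ys = by-cases (k ≟ y)
  where
  point-self : point k k ≡ 1
  point-self with k ≟ k
  ... | yes _ = refl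
  ... | no k≢k = ⊥-elim (k≢k refl)
  point-other : k ≢ y → point y k ≡ 0
  point-other k≢y with k ≟ y
  ... | yes k≡y = ⊥-elim (k≢y k≡y)
  ... | no _ = refl
  by-cases : Dec (k ≡ y) → indicator (y ∷ ys) k ≡ point y k ℕ.+ indicator ys k
  by-cases (yes refl) =
    trans (ℕP.≤-antisym (indicator-≤1 (k ∷ ys) k) (indicator-pos (k ∷ ys) k (here refl)))
          (sym (cong₂ ℕ._+_ point-self (absent (k ∈? ys))))
    where
    absent : Dec (k ∈ ys) → indicator ys k ≡ 0
    absent (yes k∈) = ⊥-elim (y∉ys k∈)
    absent (no k∉) = ℕP.n≤0⇒n≡0 (indicator-transport ys [] k k (λ k∈ → ⊥-elim (k∉ k∈)))
  by-cases (no k≢y) =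
    trans (indicator-cong (y ∷ ys) ys k drop there) (cong (ℕ._+ indicator ys k) (sym (point-other k≢y)))
    where
    drop : k ∈ y ∷ ys → k ∈ ys
    drop (here k≡y) = ⊥-elim (k≢y k≡y)
    drop (there k∈) = k∈

windowSum-point-left : ∀ y lo len → y + + 1 ≤ lo → windowSum (point y) lo len ≡ 0
windowSum-point-left y lo zero y<lo = refl
windowSum-point-left y lo (suc len) y<lo with lo ≟ y
... | yes refl = ⊥-elim (infeasible (slack y<lo) (certificate lo))
  where
  certificate : ∀ a → a - (a + + 1) ≡ -[1+ 0 ]
  certificate = solve-∀
... | no _ = windowSum-point-left y (lo + + 1) len (ℤP.≤-trans y<lo (ℤP.i≤i+j lo (+ 1)))

windowSum-point : ∀ y lo len → InWindow lo len y → windowSum (point y) lo len ≡ 1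
windowSum-point y lo zero (lo≤y , y<lo) = ⊥-elim (infeasible (slack lo≤y ⊕ slack y<lo) (certificate y lo))
  where
  certificate : ∀ a b → (a - b) + ((b + + 0) - (a + + 1)) ≡ -[1+ 0 ]
  certificate = solve-∀
windowSum-point y lo (suc len) (lo≤y , y<end) with lo ≟ y
... | yes refl = cong suc (windowSum-point-left lo (lo + + 1) len ℤP.≤-refl)
... | no lo≢y = windowSum-point y (lo + + 1) len
   (subst (_≤ y) (ℤP.+-comm (+ 1) lo) (ℤP.i<j⇒suc[i]≤j (ℤP.≤∧≢⇒< lo≤y lo≢y)) ,
    subst (y + + 1 ≤_) (sym (ℤP.+-assoc lo (+ 1) (+ len))) y<end)

length-as-windowSum : ∀ ys lo len → Unique ys → All (InWindow lo len) ys →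
                      length ys ≡ windowSum (indicator ys) lo len
length-as-windowSum [] lo len _ _ = sym (empty lo len)
  where
  empty : ∀ lo len → windowSum (indicator []) lo len ≡ 0
  empty lo zero = refl
  empty lo (suc len) = empty (lo + + 1) len
length-as-windowSum (y ∷ ys) lo len (y∉ ∷ unique) (y∈w All.∷ ys∈w) = begin
  suc (length ys)                                                  ≡⟨ cong suc (length-as-windowSum ys lo len unique ys∈w) ⟩
  1 ℕ.+ windowSum (indicator ys) lo len                            ≡⟨ cong (ℕ._+ _) (sym (windowSum-point y lo len y∈w)) ⟩
  windowSum (point y) lo len ℕ.+ windowSum (indicator ys) lo len   ≡⟨ sym (windowSum-+ (point y) (indicator ys) lo len) ⟩
  windowSum (λ k → point y k ℕ.+ indicator ys k) lo len            ≡⟨ windowSum-cong _ _ lo len (λ k → sym (indicator-∷ y ys k y∉ys)) ⟩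
  windowSum (indicator (y ∷ ys)) lo len                            ∎
  where
  open ≡-Reasoning
  y∉ys : y ∉ ys
  y∉ys y∈ = All.lookup y∉ y∈ refl

card-as-windowSum : ∀ xs lo len → All (InWindow lo len) xs → card xs ≡ windowSum (indicator xs) lo len
card-as-windowSum xs lo len xs∈w =
  trans (length-as-windowSum (deduplicate _≟_ xs) lo len (deduplicate-! xs)
          (All.tabulate (λ y∈ → All.lookup xs∈w (∈-deduplicate⁻ _≟_ xs y∈))))
        (windowSum-cong _ _ lo len
          (λ k → indicator-cong _ _ k (∈-deduplicate⁻ _≟_ xs) (∈-deduplicate⁺ _≟_)))

count : List ℤ → ℤ → ℕ → ℕ
count xs = windowSum (indicator xs)

count-shift-≤ : ∀ xs ys c lo lo' len → lo + c ≡ lo' →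
  (∀ k → InWindow lo len k → k ∈ xs → k + c ∈ ys) →
  count xs lo len ℕ.≤ count ys lo' len
count-shift-≤ xs ys c lo lo' len eq transport =
  windowSum-shift-≤ (indicator xs) (indicator ys) c lo lo' len eq
    (λ k k∈w → indicator-transport xs ys k (k + c) (transport k k∈w))

count-≤-width : ∀ xs lo len → count xs lo len ℕ.≤ len
count-≤-width xs lo len = windowSum-≤-width (indicator xs) lo len (indicator-≤1 xs)

count-full : ∀ xs lo len → (∀ k → InWindow lo len k → k ∈ xs) → len ℕ.≤ count xs lo len
count-full xs lo len covered =
  windowSum-full (indicator xs) lo len (λ k k∈w → indicator-pos xs k (covered k k∈w))

card-in-three-windows : ∀ xs lo a b c lo₂ lo₃ → lo + + a ≡ lo₂ → lo₂ + + b ≡ lo₃ →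
  All (InWindow lo (a ℕ.+ (b ℕ.+ c))) xs →
  card xs ≡ count xs lo a ℕ.+ (count xs lo₂ b ℕ.+ count xs lo₃ c)
card-in-three-windows xs lo a b c lo₂ lo₃ e₂ e₃ xs∈w =
  trans (card-as-windowSum xs lo _ xs∈w) (windowSum-split₃ (indicator xs) lo a b c lo₂ lo₃ e₂ e₃)

regroup : ∀ a b c e → a ℕ.+ (b ℕ.+ c) ℕ.+ e ≡ a ℕ.+ ((b ℕ.+ e) ℕ.+ c)
regroup = ℕ-solve-∀

module Construction (t m : ℕ) (L R M : List ℤ)
  (L⊆ : InInterval (+ 5) (+ (5 ℕ.+ t)) L)
  (R⊆ : InInterval (+ (5 ℕ.+ t) + + 1) ((+ 2) * (+ (5 ℕ.+ t)) - + 4) R)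
  (M⊆ : InInterval (+ (5 ℕ.+ t) + + 1) (+ (5 ℕ.+ t) + + m) M)
  (5∈A : + 5 ∈ L ++ R) (top∈A : ((+ 2) * (+ (5 ℕ.+ t)) - + 4) ∈ L ++ R) where

  T μ top : ℤ
  T = + t
  μ = + m
  top = (+ 2) * (+ (5 ℕ.+ t)) - + 4

  A A' S S' D D' : List ℤ
  A = L ++ R
  A' = L ++ M ++ shift μ R
  S = sumset A
  S' = sumset A'
  D = diffset A
  D' = diffset A'

  data PartOfA (x : ℤ) : Set where
    fromL : x ∈ L → PartOfA x
    fromR : x ∈ R → PartOfA x

  partOfA : ∀ {x} → x ∈ A → PartOfA x
  partOfA x∈ with ∈-++⁻ L x∈
  ... | inj₁ x∈L = fromL x∈L
  ... | inj₂ x∈R = fromR x∈R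

  data PartOfA' (x : ℤ) : Set where
    fromL : x ∈ L → PartOfA' x
    fromM : x ∈ M → PartOfA' x
    fromR : ∀ r → r ∈ R → x ≡ r + μ → PartOfA' x

  partOfA' : ∀ {x} → x ∈ A' → PartOfA' x
  partOfA' x∈ with ∈-++⁻ L x∈
  ... | inj₁ x∈L = fromL x∈L
  ... | inj₂ x∈MR with ∈-++⁻ M x∈MR
  ... | inj₁ x∈M = fromM x∈M
  ... | inj₂ x∈R' with ∈-map⁻ (λ x → x + μ) x∈R'
  ... | r , r∈R , x≡ = fromR r r∈R x≡

  L⊆A : ∀ {x} → x ∈ L → x ∈ A
  L⊆A = ∈-++⁺ˡ
  R⊆A : ∀ {x} → x ∈ R → x ∈ A
  R⊆A = ∈-++⁺ʳ L
  L⊆A' : ∀ {x} → x ∈ L → x ∈ A'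
  L⊆A' = ∈-++⁺ˡ
  R+μ⊆A' : ∀ {r} → r ∈ R → r + μ ∈ A'
  R+μ⊆A' r∈ = ∈-++⁺ʳ L (∈-++⁺ʳ M (∈-map⁺ (λ x → x + μ) r∈))

  A⊆ : ∀ {x} → x ∈ A → + 5 ≤ x × x ≤ top
  A⊆ {x} x∈ with partOfA x∈
  ... | fromL x∈L = let (5≤x , x≤n) = All.lookup L⊆ x∈L in
        5≤x , ≤-by (slack x≤n ⊕ natural (suc t)) (certificate x T)
    where certificate : ∀ x T → (+ 2) * (+ 5 + T) - + 4 ≡ x + ((+ 5 + T - x) + (+ 1 + T))
          certificate = solve-∀
  ... | fromR x∈R = let (n<x , x≤top) = All.lookup R⊆ x∈R in
        ≤-by (slack n<x ⊕ natural (suc t)) (certificate x T) , x≤top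
    where certificate : ∀ x T → x ≡ + 5 + ((x - (+ 5 + T + + 1)) + (+ 1 + T))
          certificate = solve-∀

  A'⊆ : ∀ {x} → x ∈ A' → + 5 ≤ x × x ≤ top + μ
  A'⊆ {x} x∈ with partOfA' x∈
  ... | fromL x∈L = let (5≤x , x≤n) = All.lookup L⊆ x∈L in
        5≤x , ≤-by (slack x≤n ⊕ natural (suc t) ⊕ natural m) (certificate x T μ)
    where certificate : ∀ x T M → (+ 2) * (+ 5 + T) - + 4 + M ≡ x + ((+ 5 + T - x) + (+ 1 + T) + M)
          certificate = solve-∀
  ... | fromM x∈M = let (n<x , x≤n+m) = All.lookup M⊆ x∈M in
        ≤-by (slack n<x ⊕ natural (suc t)) (certificate₁ x T) ,
        ≤-by (slack x≤n+m ⊕ natural (suc t)) (certificate₂ x T μ)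
    where certificate₁ : ∀ x T → x ≡ + 5 + ((x - (+ 5 + T + + 1)) + (+ 1 + T))
          certificate₁ = solve-∀
          certificate₂ : ∀ x T M → (+ 2) * (+ 5 + T) - + 4 + M ≡ x + ((+ 5 + T + M - x) + (+ 1 + T))
          certificate₂ = solve-∀
  ... | fromR r r∈R refl = let (n<r , r≤top) = All.lookup R⊆ r∈R in
        ≤-by (slack n<r ⊕ natural (suc t) ⊕ natural m) (certificate₁ r T μ) ,
        ≤-by (slack r≤top) (certificate₂ r T μ)
    where certificate₁ : ∀ x T M → x + M ≡ + 5 + ((x - (+ 5 + T + + 1)) + (+ 1 + T) + M)
          certificate₁ = solve-∀
          certificate₂ : ∀ x T M → (+ 2) * (+ 5 + T) - + 4 + M ≡ (x + M) + ((+ 2) * (+ 5 + T) - + 4 - x)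
          certificate₂ = solve-∀

  5∈L : + 5 ∈ L
  5∈L with partOfA 5∈A
  ... | fromL 5∈ = 5∈
  ... | fromR 5∈R = ⊥-elim (infeasible (slack (proj₁ (All.lookup R⊆ 5∈R)) ⊕ natural t) (certificate T))
    where certificate : ∀ T → (+ 5 - (+ 5 + T + + 1)) + T ≡ -[1+ 0 ]
          certificate = solve-∀

  top∈R : top ∈ R
  top∈R with partOfA top∈A
  ... | fromR top∈ = top∈
  ... | fromL top∈L = ⊥-elim (infeasible (slack (proj₂ (All.lookup L⊆ top∈L)) ⊕ natural t) (certificate T))
    where certificate : ∀ T → ((+ 5 + T) - ((+ 2) * (+ 5 + T) - + 4)) + T ≡ -[1+ 0 ]
          certificate = solve-∀

  minA : IsMin (+ 5) A
  minA = 5∈A , All.tabulate (λ x∈ → proj₁ (A⊆ x∈))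
  maxA : IsMax top A
  maxA = top∈A , All.tabulate (λ x∈ → proj₂ (A⊆ x∈))
  minA' : IsMin (+ 5) A'
  minA' = L⊆A' 5∈L , All.tabulate (λ x∈ → proj₁ (A'⊆ x∈))
  maxA' : IsMax (top + μ) A'
  maxA' = R+μ⊆A' top∈R , All.tabulate (λ x∈ → proj₂ (A'⊆ x∈))

  -- Widths of the outer windows (n-4), the central window (2n-9) and the gain 2m.
  outer central gain : ℕ
  outer = suc t
  central = suc (t ℕ.+ t)
  gain = m ℕ.+ m

  width width' : ℕ
  width = outer ℕ.+ (central ℕ.+ outer)
  width' = outer ℕ.+ ((central ℕ.+ gain) ℕ.+ outer)

  -- Left ends of the sum windows [10, n+5], [n+6, 3n-4], [3n-3, 4n-8] and of their
  -- counterparts for A' (the last one moved up by 2m).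
  sLow sMid sHigh sHigh' : ℤ
  sLow = + 10
  sMid = + 11 + T
  sHigh = + 12 + (T + T + T)
  sHigh' = sHigh + (μ + μ)

  -- Left ends of the difference windows [-(2n-9), -(n-4)], [-(n-5), n-5], [n-4, 2n-9]
  -- and of their counterparts for A' (outer ones moved out by m).
  dLow dMid dHigh dLow' dMid' dHigh' : ℤ
  dLow = - (+ 1 + (T + T))
  dMid = - T
  dHigh = + 1 + T
  dLow' = - (+ 1 + (T + T) + μ)
  dMid' = - (T + μ)
  dHigh' = + 1 + T + μ

  S-range : All (InWindow sLow width) S
  S-range = All.tabulate λ {k} k∈ → inWindow k (∈-sumset⁻ A k k∈)
    where
    inWindow : ∀ k → (∃ λ x → ∃ λ y → x ∈ A × y ∈ A × k ≡ x + y) → InWindow sLow width k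
    inWindow k (x , y , x∈ , y∈ , refl) =
      let (5≤x , x≤top) = A⊆ x∈ ; (5≤y , y≤top) = A⊆ y∈ in
      ≤-by (slack 5≤x ⊕ slack 5≤y) (certificate₁ x y) ,
      ≤-by (slack x≤top ⊕ slack y≤top) (certificate₂ x y T)
      where certificate₁ : ∀ x y → x + y ≡ + 10 + ((x - + 5) + (y - + 5))
            certificate₁ = solve-∀
            certificate₂ : ∀ x y T → + 10 + ((+ 1 + T) + ((+ 1 + (T + T)) + (+ 1 + T))) ≡
                   (x + y + + 1) + ((((+ 2) * (+ 5 + T) - + 4) - x) + (((+ 2) * (+ 5 + T) - + 4) - y))
            certificate₂ = solve-∀

  S'-range : All (InWindow sLow width') S'
  S'-range = All.tabulate λ {k} k∈ → inWindow k (∈-sumset⁻ A' k k∈)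
    where
    inWindow : ∀ k → (∃ λ x → ∃ λ y → x ∈ A' × y ∈ A' × k ≡ x + y) → InWindow sLow width' k
    inWindow k (x , y , x∈ , y∈ , refl) =
      let (5≤x , x≤top) = A'⊆ x∈ ; (5≤y , y≤top) = A'⊆ y∈ in
      ≤-by (slack 5≤x ⊕ slack 5≤y) (certificate₁ x y) ,
      ≤-by (slack x≤top ⊕ slack y≤top) (certificate₂ x y T μ)
      where certificate₁ : ∀ x y → x + y ≡ + 10 + ((x - + 5) + (y - + 5))
            certificate₁ = solve-∀
            certificate₂ : ∀ x y T M → + 10 + ((+ 1 + T) + (((+ 1 + (T + T)) + (M + M)) + (+ 1 + T))) ≡
                   (x + y + + 1) + ((((+ 2) * (+ 5 + T) - + 4 + M) - x) + (((+ 2) * (+ 5 + T) - + 4 + M) - y))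
            certificate₂ = solve-∀

  D-range : All (InWindow dLow width) D
  D-range = All.tabulate λ {k} k∈ → inWindow k (∈-diffset⁻ A k k∈)
    where
    inWindow : ∀ k → (∃ λ x → ∃ λ y → x ∈ A × y ∈ A × k ≡ x - y) → InWindow dLow width k
    inWindow k (x , y , x∈ , y∈ , refl) =
      let (5≤x , x≤top) = A⊆ x∈ ; (5≤y , y≤top) = A⊆ y∈ in
      ≤-by (slack 5≤x ⊕ slack y≤top) (certificate₁ x y T) ,
      ≤-by (slack x≤top ⊕ slack 5≤y) (certificate₂ x y T)
      where certificate₁ : ∀ x y T → x - y ≡ - (+ 1 + (T + T)) + ((x - + 5) + (((+ 2) * (+ 5 + T) - + 4) - y))
            certificate₁ = solve-∀
            certificate₂ : ∀ x y T → - (+ 1 + (T + T)) + ((+ 1 + T) + ((+ 1 + (T + T)) + (+ 1 + T))) ≡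
                   (x - y + + 1) + ((((+ 2) * (+ 5 + T) - + 4) - x) + (y - + 5))
            certificate₂ = solve-∀

  D'-range : All (InWindow dLow' width') D'
  D'-range = All.tabulate λ {k} k∈ → inWindow k (∈-diffset⁻ A' k k∈)
    where
    inWindow : ∀ k → (∃ λ x → ∃ λ y → x ∈ A' × y ∈ A' × k ≡ x - y) → InWindow dLow' width' k
    inWindow k (x , y , x∈ , y∈ , refl) =
      let (5≤x , x≤top) = A'⊆ x∈ ; (5≤y , y≤top) = A'⊆ y∈ in
      ≤-by (slack 5≤x ⊕ slack y≤top) (certificate₁ x y T μ) ,
      ≤-by (slack x≤top ⊕ slack 5≤y) (certificate₂ x y T μ)
      where certificate₁ : ∀ x y T M → x - y ≡ - (+ 1 + (T + T) + M) + ((x - + 5) + (((+ 2) * (+ 5 + T) - + 4 + M) - y))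
            certificate₁ = solve-∀
            certificate₂ : ∀ x y T M → - (+ 1 + (T + T) + M) + ((+ 1 + T) + (((+ 1 + (T + T)) + (M + M)) + (+ 1 + T))) ≡
                   (x - y + + 1) + ((((+ 2) * (+ 5 + T) - + 4 + M) - x) + (y - + 5))
            certificate₂ = solve-∀

  -- Low sums come only from L + L, which is also part of A' + A'.
  low-sums-kept : ∀ k → InWindow sLow outer k → k ∈ S → k + + 0 ∈ S'
  low-sums-kept k k∈w k∈S =
    subst (_∈ S') (sym (ℤP.+-identityʳ k)) (fromSum (∈-sumset⁻ A k k∈S))
    where
    fromSum : (∃ λ x → ∃ λ y → x ∈ A × y ∈ A × k ≡ x + y) → k ∈ S'
    fromSum (x , y , x∈ , y∈ , refl) with partOfA x∈ | partOfA y∈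
    ... | fromL x∈L | fromL y∈L = ∈-sumset⁺ A' (L⊆A' x∈L) (L⊆A' y∈L)
    ... | fromR x∈R | _ = ⊥-elim (infeasible
          (slack (proj₁ (All.lookup R⊆ x∈R)) ⊕ slack (proj₁ (A⊆ y∈)) ⊕ slack (proj₂ k∈w)) (certificate x y T))
      where certificate : ∀ x y T → (x - (+ 5 + T + + 1)) + (y - + 5) + ((+ 10 + (+ 1 + T)) - ((x + y) + + 1)) ≡ -[1+ 0 ]
            certificate = solve-∀
    ... | fromL _ | fromR y∈R = ⊥-elim (infeasible
          (slack (proj₁ (A⊆ x∈)) ⊕ slack (proj₁ (All.lookup R⊆ y∈R)) ⊕ slack (proj₂ k∈w)) (certificate x y T))
      where certificate : ∀ x y T → (x - + 5) + (y - (+ 5 + T + + 1)) + ((+ 10 + (+ 1 + T)) - ((x + y) + + 1)) ≡ -[1+ 0 ]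
            certificate = solve-∀

  -- High sums come only from R + R, which reappears in A' + A' moved up by 2m.
  high-sums-shifted : ∀ k → InWindow sHigh outer k → k ∈ S → k + (μ + μ) ∈ S'
  high-sums-shifted k k∈w k∈S = fromSum (∈-sumset⁻ A k k∈S)
    where
    fromSum : (∃ λ x → ∃ λ y → x ∈ A × y ∈ A × k ≡ x + y) → k + (μ + μ) ∈ S'
    fromSum (x , y , x∈ , y∈ , refl) with partOfA x∈ | partOfA y∈
    ... | fromR x∈R | fromR y∈R = subst (_∈ S') (regroup-shift x y μ) (∈-sumset⁺ A' (R+μ⊆A' x∈R) (R+μ⊆A' y∈R))
      where regroup-shift : ∀ x y M → (x + M) + (y + M) ≡ (x + y) + (M + M)
            regroup-shift = solve-∀
    ... | fromL x∈L | _ = ⊥-elim (infeasible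
          (slack (proj₂ (All.lookup L⊆ x∈L)) ⊕ slack (proj₂ (A⊆ y∈)) ⊕ slack (proj₁ k∈w)) (certificate x y T))
      where certificate : ∀ x y T → ((+ 5 + T) - x) + (((+ 2) * (+ 5 + T) - + 4) - y) + ((x + y) - (+ 12 + (T + T + T))) ≡ -[1+ 0 ]
            certificate = solve-∀
    ... | fromR _ | fromL y∈L = ⊥-elim (infeasible
          (slack (proj₂ (A⊆ x∈)) ⊕ slack (proj₂ (All.lookup L⊆ y∈L)) ⊕ slack (proj₁ k∈w)) (certificate x y T))
      where certificate : ∀ x y T → (((+ 2) * (+ 5 + T) - + 4) - x) + ((+ 5 + T) - y) + ((x + y) - (+ 12 + (T + T + T))) ≡ -[1+ 0 ]
            certificate = solve-∀

  central-sums-full : SP (+ (5 ℕ.+ t) - + 4) A' → ∀ k → InWindow sMid (central ℕ.+ gain) k → k ∈ S'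
  central-sums-full sp k (sMid≤k , k<end) =
    sp (+ 5) (top + μ) minA' maxA' k (≤-by (slack sMid≤k) (certificate₁ k T)) (≤-by (slack k<end) (certificate₂ k T μ))
    where
    certificate₁ : ∀ k T → k ≡ ((+ 2) * (+ 5) + ((+ 5 + T) - + 4)) + (k - (+ 11 + T))
    certificate₁ = solve-∀
    certificate₂ : ∀ k T M → (+ 2) * ((+ 2) * (+ 5 + T) - + 4 + M) - ((+ 5 + T) - + 4) ≡
                     k + (((+ 11 + T) + ((+ 1 + (T + T)) + (M + M))) - (k + + 1))
    certificate₂ = solve-∀

  central-diffs-full : P (+ (5 ℕ.+ t) - + 4) A → ∀ k → InWindow dMid central k → k ∈ D
  central-diffs-full (_ , dp) k (dMid≤k , k<end) =
    dp (+ 5) top minA maxA k (≤-by (slack dMid≤k) (certificate₁ k T)) (≤-by (slack k<end) (certificate₂ k T))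
    where
    certificate₁ : ∀ k T → k ≡ ((+ 5 - ((+ 2) * (+ 5 + T) - + 4)) + ((+ 5 + T) - + 4)) + (k - - T)
    certificate₁ = solve-∀
    certificate₂ : ∀ k T → (((+ 2) * (+ 5 + T) - + 4) - + 5) - ((+ 5 + T) - + 4) ≡
                     k + ((- T + (+ 1 + (T + T))) - (k + + 1))
    certificate₂ = solve-∀

  large-difference : ∀ {x y} → x ∈ A' → y ∈ A' → + 1 + T + μ ≤ x - y →
                     ∃ λ r → r ∈ R × x ≡ r + μ × y ∈ L
  large-difference {x} {y} x∈ y∈ large with partOfA' y∈
  ... | fromM y∈M = ⊥-elim (infeasible
        (slack large ⊕ slack (proj₁ (All.lookup M⊆ y∈M)) ⊕ slack (proj₂ (A'⊆ x∈))) (certificate x y T μ))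
    where certificate : ∀ x y T M → ((x - y) - (+ 1 + T + M)) + (y - (+ 5 + T + + 1)) + (((+ 2) * (+ 5 + T) - + 4 + M) - x) ≡ -[1+ 0 ]
          certificate = solve-∀
  ... | fromR r r∈R refl = ⊥-elim (infeasible
        (slack large ⊕ slack (proj₁ (All.lookup R⊆ r∈R)) ⊕ slack (proj₂ (A'⊆ x∈)) ⊕ natural m) (certificate x r T μ))
    where certificate : ∀ x r T M → ((x - (r + M)) - (+ 1 + T + M)) + (r - (+ 5 + T + + 1)) + (((+ 2) * (+ 5 + T) - + 4 + M) - x) + M ≡ -[1+ 0 ]
          certificate = solve-∀
  ... | fromL y∈L with partOfA' x∈
  ...   | fromR r r∈R x≡ = r , r∈R , x≡ , y∈L
  ...   | fromL x∈L = ⊥-elim (infeasible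
          (slack large ⊕ slack (proj₂ (All.lookup L⊆ x∈L)) ⊕ slack (proj₁ (All.lookup L⊆ y∈L)) ⊕ natural m) (certificate x y T μ))
    where certificate : ∀ x y T M → ((x - y) - (+ 1 + T + M)) + ((+ 5 + T) - x) + (y - + 5) + M ≡ -[1+ 0 ]
          certificate = solve-∀
  ...   | fromM x∈M = ⊥-elim (infeasible
          (slack large ⊕ slack (proj₂ (All.lookup M⊆ x∈M)) ⊕ slack (proj₁ (All.lookup L⊆ y∈L))) (certificate x y T μ))
    where certificate : ∀ x y T M → ((x - y) - (+ 1 + T + M)) + ((+ 5 + T + M) - x) + (y - + 5) ≡ -[1+ 0 ]
          certificate = solve-∀

  low-diffs-shifted : ∀ k → InWindow dLow' outer k → k ∈ D' → k + μ ∈ D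
  low-diffs-shifted k (_ , k<end) k∈D' = fromDiff (∈-diffset⁻ A' k k∈D')
    where
    fromDiff : (∃ λ x → ∃ λ y → x ∈ A' × y ∈ A' × k ≡ x - y) → k + μ ∈ D
    fromDiff (x , y , x∈ , y∈ , refl)
      with large-difference y∈ x∈ (≤-by (slack k<end) (certificate x y T μ))
      where certificate : ∀ x y T M → y - x ≡ (+ 1 + T + M) + ((- (+ 1 + (T + T) + M) + (+ 1 + T)) - ((x - y) + + 1))
            certificate = solve-∀
    ... | r , r∈R , refl , x∈L = subst (_∈ D) (unshift x r μ) (∈-diffset⁺ A (L⊆A x∈L) (R⊆A r∈R))
      where unshift : ∀ x r M → x - r ≡ (x - (r + M)) + M
            unshift = solve-∀

  high-diffs-shifted : ∀ k → InWindow dHigh' outer k → k ∈ D' → k + - μ ∈ D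
  high-diffs-shifted k (dHigh'≤k , _) k∈D' = fromDiff (∈-diffset⁻ A' k k∈D')
    where
    fromDiff : (∃ λ x → ∃ λ y → x ∈ A' × y ∈ A' × k ≡ x - y) → k + - μ ∈ D
    fromDiff (x , y , x∈ , y∈ , refl) with large-difference x∈ y∈ dHigh'≤k
    ... | r , r∈R , refl , y∈L = subst (_∈ D) (unshift r y μ) (∈-diffset⁺ A (R⊆A r∈R) (L⊆A y∈L))
      where unshift : ∀ r y M → r - y ≡ ((r + M) - y) + - M
            unshift = solve-∀

  sMid-adjacent : sLow + + outer ≡ sMid
  sMid-adjacent = identity T
    where identity : ∀ T → + 10 + (+ 1 + T) ≡ + 11 + T
          identity = solve-∀

  sHigh-adjacent : sMid + + central ≡ sHigh
  sHigh-adjacent = identity T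
    where identity : ∀ T → (+ 11 + T) + (+ 1 + (T + T)) ≡ + 12 + (T + T + T)
          identity = solve-∀

  sHigh'-adjacent : sMid + + (central ℕ.+ gain) ≡ sHigh'
  sHigh'-adjacent = identity T μ
    where identity : ∀ T M → (+ 11 + T) + ((+ 1 + (T + T)) + (M + M)) ≡ + 12 + (T + T + T) + (M + M)
          identity = solve-∀

  dMid-adjacent : dLow + + outer ≡ dMid
  dMid-adjacent = identity T
    where identity : ∀ T → - (+ 1 + (T + T)) + (+ 1 + T) ≡ - T
          identity = solve-∀

  dHigh-adjacent : dMid + + central ≡ dHigh
  dHigh-adjacent = identity T
    where identity : ∀ T → - T + (+ 1 + (T + T)) ≡ + 1 + T
          identity = solve-∀

  dMid'-adjacent : dLow' + + outer ≡ dMid'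
  dMid'-adjacent = identity T μ
    where identity : ∀ T M → - (+ 1 + (T + T) + M) + (+ 1 + T) ≡ - (T + M)
          identity = solve-∀

  dHigh'-adjacent : dMid' + + (central ℕ.+ gain) ≡ dHigh'
  dHigh'-adjacent = identity T μ
    where identity : ∀ T M → - (T + M) + ((+ 1 + (T + T)) + (M + M)) ≡ + 1 + T + M
          identity = solve-∀

  dLow'-shifted : dLow' + μ ≡ dLow
  dLow'-shifted = identity T μ
    where identity : ∀ T M → - (+ 1 + (T + T) + M) + M ≡ - (+ 1 + (T + T))
          identity = solve-∀

  dHigh'-shifted : dHigh' + - μ ≡ dHigh
  dHigh'-shifted = identity T μ
    where identity : ∀ T M → (+ 1 + T + M) + - M ≡ + 1 + T
          identity = solve-∀

  -- |A+A| + 2m ≤ |A'+A'|: the outer windows are kept, the central one grows by 2m.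
  sumset-growth : SP (+ (5 ℕ.+ t) - + 4) A' → card S ℕ.+ gain ℕ.≤ card S'
  sumset-growth sp = begin
    card S ℕ.+ gain
      ≡⟨ cong (ℕ._+ gain) (card-in-three-windows S sLow outer central outer sMid sHigh sMid-adjacent sHigh-adjacent S-range) ⟩
    count S sLow outer ℕ.+ (count S sMid central ℕ.+ count S sHigh outer) ℕ.+ gain
      ≤⟨ ℕP.+-monoˡ-≤ gain (ℕP.+-monoʳ-≤ (count S sLow outer) (ℕP.+-monoˡ-≤ _ (count-≤-width S sMid central))) ⟩
    count S sLow outer ℕ.+ (central ℕ.+ count S sHigh outer) ℕ.+ gain
      ≡⟨ regroup _ central _ gain ⟩
    count S sLow outer ℕ.+ ((central ℕ.+ gain) ℕ.+ count S sHigh outer)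
      ≤⟨ ℕP.+-mono-≤ low (ℕP.+-mono-≤ central-full high) ⟩
    count S' sLow outer ℕ.+ (count S' sMid (central ℕ.+ gain) ℕ.+ count S' sHigh' outer)
      ≡⟨ sym (card-in-three-windows S' sLow outer (central ℕ.+ gain) outer sMid sHigh' sMid-adjacent sHigh'-adjacent S'-range) ⟩
    card S' ∎
    where
    open ℕP.≤-Reasoning
    low = count-shift-≤ S S' (+ 0) sLow sLow outer (ℤP.+-identityʳ sLow) low-sums-kept
    high = count-shift-≤ S S' (μ + μ) sHigh sHigh' outer refl high-sums-shifted
    central-full = count-full S' sMid (central ℕ.+ gain) (central-sums-full sp)

  -- |A'-A'| ≤ |A-A| + 2m: the outer windows embed, the central one grows by at most 2m.
  diffset-growth : P (+ (5 ℕ.+ t) - + 4) A → card D' ℕ.≤ card D ℕ.+ gain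
  diffset-growth pa = begin
    card D'
      ≡⟨ card-in-three-windows D' dLow' outer (central ℕ.+ gain) outer dMid' dHigh' dMid'-adjacent dHigh'-adjacent D'-range ⟩
    count D' dLow' outer ℕ.+ (count D' dMid' (central ℕ.+ gain) ℕ.+ count D' dHigh' outer)
      ≤⟨ ℕP.+-mono-≤ low (ℕP.+-mono-≤ (count-≤-width D' dMid' (central ℕ.+ gain)) high) ⟩
    count D dLow outer ℕ.+ ((central ℕ.+ gain) ℕ.+ count D dHigh outer)
      ≡⟨ sym (regroup _ central _ gain) ⟩
    count D dLow outer ℕ.+ (central ℕ.+ count D dHigh outer) ℕ.+ gain
      ≤⟨ ℕP.+-monoˡ-≤ gain (ℕP.+-monoʳ-≤ (count D dLow outer) (ℕP.+-monoˡ-≤ _ central-full)) ⟩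
    count D dLow outer ℕ.+ (count D dMid central ℕ.+ count D dHigh outer) ℕ.+ gain
      ≡⟨ cong (ℕ._+ gain) (sym (card-in-three-windows D dLow outer central outer dMid dHigh dMid-adjacent dHigh-adjacent D-range)) ⟩
    card D ℕ.+ gain ∎
    where
    open ℕP.≤-Reasoning
    low = count-shift-≤ D' D μ dLow' dLow outer dLow'-shifted low-diffs-shifted
    high = count-shift-≤ D' D (- μ) dHigh' dHigh outer dHigh'-shifted high-diffs-shifted
    central-full = count-full D dMid central (central-diffs-full pa)

corollary2p2 : (n : ℕ) → 5 Data.Nat.≤ n →
    (L R : List ℤ) → InInterval (+ 5) (+ n) L → InInterval (+ n + + 1) ((+ 2) * (+ n) - + 4) R →
    MSTD (L ++ R) → P (+ n - + 4) (L ++ R) →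
    (+ 5) ∈ (L ++ R) → ((+ 2) * (+ n) - + 4) ∈ (L ++ R) →
    (m : ℕ) → (M : List ℤ) → InInterval (+ n + + 1) (+ n + + m) M →
    SP (+ n - + 4) (L ++ M ++ shift (+ m) R) →
    MSTD (L ++ M ++ shift (+ m) R)
corollary2p2 n (s≤s (s≤s (s≤s (s≤s (s≤s {n = t} _))))) L R L⊆ R⊆ mstd pA 5∈A top∈A m M M⊆ spA' = begin-strict
  card D'          ≤⟨ diffset-growth pA ⟩
  card D ℕ.+ gain  <⟨ ℕP.+-monoˡ-< gain mstd ⟩
  card S ℕ.+ gain  ≤⟨ sumset-growth spA' ⟩
  card S'          ∎
  where
  open ℕP.≤-Reasoning
  open Construction t m L R M L⊆ R⊆ M⊆ 5∈A top∈A
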